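{- Let $G=(V,E)$ be an unweighted undirected graph with shortest-path metric $d$, let $k,\alpha$ be non-negative integers with $\alpha<k$, and let $L:V\to\mathbb{Z}_{\ge0}$. Let $A\subseteq V$ be a $7$-independent set in $G$; for each $a\in A$ let $B(a)$ be any set of $\alpha$ vertices in $N(a)$, and let $B=\bigcup_{a\in A}B(a)$. If $(G,k,L,\alpha)$ is feasible for the capacitated conservative $\alpha$-fault-tolerant $k$-center, then $(G,k-|B|,L')$ is feasible for the capacitated $k$-center, where $L'_u=0$ for $u\in B$ and $L'_u=L_u$ otherwise.
   Context: A set $A\subseteq V$ is $7$-independent if $d(a,b)\ge 7$ for every pair of distinct $a,b\in A$. $N(a)=\{v: d(a,v)\le 1\}$. An instance $(G,k',L')$ of the capacitated $k$-center is feasible if there exist a set $S\subseteq V$ of $k'$ centers and an assignment $\phi:V\to S$ with $d(u,\phi(u))\le1$ for all $u$ and $|\phi^{ -1}(v)|\le L'_v$ for all $v\in S$. The instance $(G,k,L,\alpha)$ of the capacitated conservative $\alpha$-fault-tolerant $k$-center is feasible if there is a pair $(S,\phi_0)$ with $S\subseteq V$, $|S|=k$, $\phi_0:V\to S$ with $|\phi_0^{ -1}(v)|\le L_v$ and $d(u,\phi_0(u))\le1$, such that for every $F\subseteq S$ with $|F|\le\alpha$ there is an assignment $\phi_F:V\to S\setminus F$ respecting the capacities $L$, with $d(u,\phi_F(u))\le1$ for all $u$, and with $\phi_F(u)=\phi_0(u)$ whenever $\phi_0(u)\notin F$. -}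

module Defs where

open import Data.Nat using (ℕ; zero; suc; _≤_; _<_; _∸_)
open import Data.Bool using (Bool; true; false; if_then_else_; _∧_)
open import Data.Fin using (Fin; _≟_)
open import Data.Fin.Subset using (Subset; _∈_; _∉_; _⊆_; ∣_∣)
open import Data.Vec using (lookup; tabulate)
open import Data.List using (allFin)
open import Data.Bool.ListAction using (any)
open import Data.Product using (Σ; _×_)
open import Data.Sum using (_⊎_)
open import Relation.Binary.PropositionalEquality using (_≡_)
open import Relation.Nullary using (¬_)
open import Relation.Nullary.Decidable using (⌊_⌋)

record Graph (n : ℕ) : Set where
  field
    adj     : Fin n → Fin n → Bool
    adj-sym : ∀ u v → adj u v ≡ adj v u

module _ {n : ℕ} (G : Graph n) where
  open Graph G

  -- Walk m u v : there is a walk from u to v of length at most m,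
  -- i.e. d(u,v) ≤ m for the shortest-path metric d.
  data Walk : ℕ → Fin n → Fin n → Set where
    here : ∀ {m u} → Walk m u u
    step : ∀ {m u w v} → adj u w ≡ true → Walk m w v → Walk (suc m) u v

  Close : Fin n → Fin n → Set
  Close u v = Walk 1 u v

  InN : Fin n → Fin n → Set
  InN a v = Close a v

  SevenIndependent : Subset n → Set
  SevenIndependent A = ∀ a b → a ∈ A → b ∈ A → ¬ (a ≡ b) → ¬ Walk 6 a b

preimage : ∀ {n} → (Fin n → Fin n) → Fin n → Subset n
preimage φ v = tabulate (λ u → ⌊ φ u ≟ v ⌋)

module _ {n : ℕ} (G : Graph n) where

  ValidAssignment : Subset n → (Fin n → ℕ) → (Fin n → Fin n) → Set
  ValidAssignment S L φ =
    (∀ u → φ u ∈ S) × (∀ u → Close G u (φ u)) × (∀ v → v ∈ S → ∣ preimage φ v ∣ ≤ L v)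

  CapFeasible : ℕ → (Fin n → ℕ) → Set
  CapFeasible k' L' =
    Σ (Subset n) λ S → (∣ S ∣ ≡ k') × Σ (Fin n → Fin n) λ φ → ValidAssignment S L' φ

  ConsFTFeasible : ℕ → (Fin n → ℕ) → ℕ → Set
  ConsFTFeasible k L α =
    Σ (Subset n) λ S → (∣ S ∣ ≡ k) × Σ (Fin n → Fin n) λ φ₀ → ValidAssignment S L φ₀ ×
      ((F : Subset n) → F ⊆ S → ∣ F ∣ ≤ α →
        Σ (Fin n → Fin n) λ φF →
          (∀ u → φF u ∉ F) × ValidAssignment S L φF × (∀ u → φ₀ u ∉ F → φF u ≡ φ₀ u))

bigUnion : ∀ {n} → Subset n → (Fin n → Subset n) → Subset n
bigUnion {n} A Bf = tabulate (λ u → any (λ a → lookup A a ∧ lookup (Bf a) u) (allFin n))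

zeroOn : ∀ {n} → Subset n → (Fin n → ℕ) → Fin n → ℕ
zeroOn B L u = if lookup B u then 0 else L u

-- Every closed neighbourhood N(a) holds more than α centres of S: otherwise failing all of them
-- would leave a without a centre.  So for a ∈ A we can pick F(a) with B(a) ∩ S ⊆ F(a) ⊆ S ∩ N(a)
-- and |F(a)| = α, and fault tolerance yields a repair ψ_a of φ₀ after the failure of F(a).
-- Remove U = ⋃ F(a) from S and send u to ψ_a(u) when φ₀(u) ∈ F(a), to φ₀(u) otherwise.
-- By 7-independence the F(a) are disjoint, as are the B(a), so |U| = α|A| = |B|; and the centres
-- used by different ψ_a are at distance ≤ 3 from different a, hence distinct, so every surviving
-- centre is loaded as under φ₀ or as under a single ψ_a.  Finally B ∩ S ⊆ U.
module Submission where

open import Defs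
open import Data.Nat using (ℕ; zero; suc; _+_; _≤_; _<_; _∸_; z≤n; s≤s; _≤?_; _<?_)
open import Data.Nat.Properties using (+-suc; +-∸-assoc; ≤-refl; ≤-trans; ≤-reflexive; <⇒≤; ≰⇒>; ≮⇒≥; ≤-pred; m≤n+m)
open import Data.Nat.ListAction using (sum)
open import Data.Bool using (Bool; true; false; T; if_then_else_; _∧_; _∨_)
open import Data.Bool.Properties using (T-≡; T-∧)
open import Data.Bool.ListAction using (any; or)
open import Data.Fin using (Fin; _≟_)
open import Data.Fin.Properties using (any?)
open import Data.Fin.Subset using (Subset; inside; outside; _∈_; _∉_; _⊆_; ∣_∣; ⊥; _∩_; _∪_; _─_; ⋃)
open import Data.Fin.Subset.Properties
  using (_∈?_; ∉⊥; ∣⊥∣≡0; x∈p∪q⁻; x∈p∩q⁺; x∈p∩q⁻; p∩q⊆p; ∣p∩q∣≤∣p∣; p─q⊆p; x∈p∧x∉q⇒x∈p─q;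
         p⊆q⇒∣p∣≤∣q∣; drop-∷-⊆; s⊆s; out⊆)
open import Data.Vec using ([]; _∷_; here; there; lookup; tabulate)
open import Data.Vec.Properties
  using (lookup∘tabulate; tabulate∘lookup; tabulate-cong; lookup-zipWith; lookup-replicate; []=⇒lookup; lookup⇒[]=)
open import Data.List using (List; []; _∷_; map; allFin)
open import Data.List.Properties using (map-∘; map-cong)
open import Data.List.Relation.Unary.All using (All; []; _∷_)
open import Data.List.Relation.Unary.AllPairs using (AllPairs; []; _∷_)
import Data.List.Relation.Unary.AllPairs as AllPairs
open import Data.List.Relation.Unary.AllPairs.Properties using (map⁺)
open import Data.List.Relation.Unary.Any using (satisfied)
import Data.List.Relation.Unary.Any as Any
open import Data.List.Relation.Unary.Any.Properties using (any⁺; any⁻)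
open import Data.List.Relation.Unary.Unique.Propositional.Properties using (allFin⁺)
open import Data.List.Membership.Propositional.Properties using (∈-allFin)
open import Data.Product using (Σ; ∃; ∃-syntax; _×_; _,_; proj₁; proj₂)
open import Data.Sum using ([_,_]′)
open import Function using (_∘_; Equivalence)
open import Relation.Binary.PropositionalEquality
open import Relation.Nullary using (¬_; Dec; yes; no; contradiction; _×-dec_)
open import Relation.Nullary.Decidable using (⌊_⌋; toWitness; fromWitness; map′)

private
  variable
    m n : ℕ
    x : Fin n
    p q : Subset n

Disjoint : Subset n → Subset n → Set
Disjoint p q = ∀ {x} → x ∈ p → x ∉ q

∈⇒T-lookup : x ∈ p → T (lookup p x)
∈⇒T-lookup x∈p = Equivalence.from T-≡ ([]=⇒lookup x∈p)

T-lookup⇒∈ : T (lookup p x) → x ∈ p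
T-lookup⇒∈ t = lookup⇒[]= _ _ (Equivalence.to T-≡ t)

∈-tabulate⁺ : ∀ {f : Fin n → Bool} → T (f x) → x ∈ tabulate f
∈-tabulate⁺ {x = x} {f} t = T-lookup⇒∈ (subst T (sym (lookup∘tabulate f x)) t)

∈-tabulate⁻ : ∀ {f : Fin n → Bool} → x ∈ tabulate f → T (f x)
∈-tabulate⁻ {x = x} {f} x∈ = subst T (lookup∘tabulate f x) (∈⇒T-lookup x∈)

Disjoint-∷ : ∀ {s t} → Disjoint (s ∷ p) (t ∷ q) → Disjoint p q
Disjoint-∷ d x∈p x∈q = d (there x∈p) (there x∈q)

∣p∪q∣≡∣p∣+∣q∣ : ∀ (p q : Subset n) → Disjoint p q → ∣ p ∪ q ∣ ≡ ∣ p ∣ + ∣ q ∣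
∣p∪q∣≡∣p∣+∣q∣ []            []            _ = refl
∣p∪q∣≡∣p∣+∣q∣ (inside  ∷ p) (inside  ∷ q) d = contradiction here (d here)
∣p∪q∣≡∣p∣+∣q∣ (inside  ∷ p) (outside ∷ q) d = cong suc (∣p∪q∣≡∣p∣+∣q∣ p q (Disjoint-∷ d))
∣p∪q∣≡∣p∣+∣q∣ (outside ∷ p) (inside  ∷ q) d =
  trans (cong suc (∣p∪q∣≡∣p∣+∣q∣ p q (Disjoint-∷ d))) (sym (+-suc ∣ p ∣ ∣ q ∣))
∣p∪q∣≡∣p∣+∣q∣ (outside ∷ p) (outside ∷ q) d = ∣p∪q∣≡∣p∣+∣q∣ p q (Disjoint-∷ d)

∣p─q∣≡∣p∣∸∣q∣ : ∀ (p q : Subset n) → q ⊆ p → ∣ p ─ q ∣ ≡ ∣ p ∣ ∸ ∣ q ∣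
∣p─q∣≡∣p∣∸∣q∣ []            []            _   = refl
∣p─q∣≡∣p∣∸∣q∣ (s       ∷ p) (inside  ∷ q) q⊆p with q⊆p here
... | here = ∣p─q∣≡∣p∣∸∣q∣ p q (drop-∷-⊆ q⊆p)
∣p─q∣≡∣p∣∸∣q∣ (inside  ∷ p) (outside ∷ q) q⊆p = begin
  suc ∣ p ─ q ∣     ≡⟨ cong suc (∣p─q∣≡∣p∣∸∣q∣ p q (drop-∷-⊆ q⊆p)) ⟩
  suc (∣ p ∣ ∸ ∣ q ∣) ≡⟨ +-∸-assoc 1 (p⊆q⇒∣p∣≤∣q∣ (drop-∷-⊆ q⊆p)) ⟨
  suc ∣ p ∣ ∸ ∣ q ∣   ∎
  where open ≡-Reasoning
∣p─q∣≡∣p∣∸∣q∣ (outside ∷ p) (outside ∷ q) q⊆p = ∣p─q∣≡∣p∣∸∣q∣ p q (drop-∷-⊆ q⊆p)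

x∈p─q⇒x∉q : ∀ (p q : Subset n) → x ∈ p ─ q → x ∉ q
x∈p─q⇒x∉q (inside ∷ p) (outside ∷ q) here        ()
x∈p─q⇒x∉q (_      ∷ p) (_       ∷ q) (there x∈) (there x∈q) = x∈p─q⇒x∉q p q x∈ x∈q

⊆-interpolate : ∀ {p q : Subset n} {m} → p ⊆ q → ∣ p ∣ ≤ m → m ≤ ∣ q ∣ →
                ∃[ r ] p ⊆ r × r ⊆ q × ∣ r ∣ ≡ m
⊆-interpolate {p = []} {[]} _ z≤n z≤n = [] , (λ ()) , (λ ()) , refl
⊆-interpolate {p = inside ∷ p} {outside ∷ q} p⊆q _ _ with () ← p⊆q here
⊆-interpolate {p = inside ∷ p} {inside ∷ q} p⊆q (s≤s ∣p∣≤m) (s≤s m≤∣q∣)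
  with r , p⊆r , r⊆q , ∣r∣≡m ← ⊆-interpolate (drop-∷-⊆ p⊆q) ∣p∣≤m m≤∣q∣
  = inside ∷ r , s⊆s p⊆r , s⊆s r⊆q , cong suc ∣r∣≡m
⊆-interpolate {p = outside ∷ p} {outside ∷ q} p⊆q ∣p∣≤m m≤∣q∣
  with r , p⊆r , r⊆q , ∣r∣≡m ← ⊆-interpolate (drop-∷-⊆ p⊆q) ∣p∣≤m m≤∣q∣
  = outside ∷ r , s⊆s p⊆r , s⊆s r⊆q , ∣r∣≡m
⊆-interpolate {p = outside ∷ p} {inside ∷ q} {m} p⊆q ∣p∣≤m m≤1+∣q∣ with m ≤? ∣ q ∣
... | yes m≤∣q∣ with r , p⊆r , r⊆q , ∣r∣≡m ← ⊆-interpolate (drop-∷-⊆ p⊆q) ∣p∣≤m m≤∣q∣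
  = outside ∷ r , s⊆s p⊆r , out⊆ r⊆q , ∣r∣≡m
⊆-interpolate {p = outside ∷ p} {inside ∷ q} {suc m} p⊆q ∣p∣≤m (s≤s m≤∣q∣) | no m≰∣q∣
  with r , p⊆r , r⊆q , ∣r∣≡m ← ⊆-interpolate (drop-∷-⊆ p⊆q)
         (≤-pred (≤-trans (s≤s (p⊆q⇒∣p∣≤∣q∣ (drop-∷-⊆ p⊆q))) (≰⇒> m≰∣q∣))) m≤∣q∣
  = inside ∷ r , out⊆ p⊆r , s⊆s r⊆q , cong suc ∣r∣≡m
⊆-interpolate {p = outside ∷ p} {inside ∷ q} {zero} _ _ _ | no m≰∣q∣ = contradiction z≤n m≰∣q∣

Disjoint-⋃ : ∀ {qs : List (Subset n)} → All (Disjoint p) qs → Disjoint p (⋃ qs)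
Disjoint-⋃ {qs = []}     []       _   x∈⊥  = ∉⊥ x∈⊥
Disjoint-⋃ {qs = q ∷ qs} (d ∷ ds) x∈p x∈⋃ = [ d x∈p , Disjoint-⋃ ds x∈p ]′ (x∈p∪q⁻ q (⋃ qs) x∈⋃)

∣⋃∣≡sum : ∀ {ps : List (Subset n)} → AllPairs Disjoint ps → ∣ ⋃ ps ∣ ≡ sum (map ∣_∣ ps)
∣⋃∣≡sum {n = n} {ps = []} [] = ∣⊥∣≡0 n
∣⋃∣≡sum {ps = p ∷ ps} (ds ∷ dss) =
  trans (∣p∪q∣≡∣p∣+∣q∣ p (⋃ ps) (Disjoint-⋃ ds)) (cong (∣ p ∣ +_) (∣⋃∣≡sum dss))

lookup-⋃ : ∀ (ps : List (Subset n)) x → lookup (⋃ ps) x ≡ any (λ p → lookup p x) ps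
lookup-⋃ []       x = lookup-replicate x outside
lookup-⋃ (p ∷ ps) x = trans (lookup-zipWith _∨_ x p (⋃ ps)) (cong (lookup p x ∨_) (lookup-⋃ ps x))

restrict : Subset m → (Fin m → Subset n) → Fin m → Subset n
restrict A P a = if lookup A a then P a else ⊥

module _ (A : Subset m) (P : Fin m → Subset n) where

  lookup-restrict : ∀ a x → lookup (restrict A P a) x ≡ lookup A a ∧ lookup (P a) x
  lookup-restrict a x with lookup A a
  ... | true  = refl
  ... | false = lookup-replicate x outside

  ∈-restrict⁺ : ∀ {a} → a ∈ A → x ∈ P a → x ∈ restrict A P a
  ∈-restrict⁺ {a = a} a∈A x∈Pa rewrite []=⇒lookup a∈A = x∈Pa

  ∈-restrict⁻ : ∀ {a} → x ∈ restrict A P a → a ∈ A × x ∈ P a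
  ∈-restrict⁻ {a = a} x∈ with lookup A a in eq
  ... | true  = lookup⇒[]= a A eq , x∈
  ... | false = contradiction x∈ ∉⊥

  ∣restrict∣≤ : ∀ {k} → (∀ a → a ∈ A → ∣ P a ∣ ≤ k) → ∀ a → ∣ restrict A P a ∣ ≤ k
  ∣restrict∣≤ {k} ∣P∣≤k a with lookup A a in eq
  ... | true  = ∣P∣≤k a (lookup⇒[]= a A eq)
  ... | false = subst (_≤ k) (sym (∣⊥∣≡0 n)) z≤n

  ∣restrict∣-cong : ∀ (Q : Fin m → Subset n) → (∀ a → a ∈ A → ∣ P a ∣ ≡ ∣ Q a ∣) →
                    ∀ a → ∣ restrict A P a ∣ ≡ ∣ restrict A Q a ∣
  ∣restrict∣-cong Q ∣P∣≡∣Q∣ a with lookup A a in eq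
  ... | true  = ∣P∣≡∣Q∣ a (lookup⇒[]= a A eq)
  ... | false = refl

module _ (A : Subset n) (P : Fin n → Subset n) where

  ∈-bigUnion⁺ : ∀ {a} → a ∈ A → x ∈ P a → x ∈ bigUnion A P
  ∈-bigUnion⁺ {a = a} a∈A x∈Pa =
    ∈-tabulate⁺ (any⁺ _ (Any.map (λ { refl → Equivalence.from T-∧ (∈⇒T-lookup a∈A , ∈⇒T-lookup x∈Pa) })
                                 (∈-allFin a)))

  ∈-bigUnion⁻ : x ∈ bigUnion A P → ∃[ a ] a ∈ A × x ∈ P a
  ∈-bigUnion⁻ x∈ with a , t ← satisfied (any⁻ _ (allFin n) (∈-tabulate⁻ x∈))
    = a , T-lookup⇒∈ (proj₁ (Equivalence.to T-∧ t)) , T-lookup⇒∈ (proj₂ (Equivalence.to T-∧ t))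

  bigUnion≡⋃ : bigUnion A P ≡ ⋃ (map (restrict A P) (allFin n))
  bigUnion≡⋃ = begin
    tabulate (λ x → any (λ a → lookup A a ∧ lookup (P a) x) (allFin n))
      ≡⟨ tabulate-cong (λ x → any-restrict x) ⟩
    tabulate (lookup (⋃ (map (restrict A P) (allFin n))))
      ≡⟨ tabulate∘lookup _ ⟩
    ⋃ (map (restrict A P) (allFin n)) ∎
    where
    open ≡-Reasoning
    any-restrict : ∀ x → any (λ a → lookup A a ∧ lookup (P a) x) (allFin n)
                       ≡ lookup (⋃ (map (restrict A P) (allFin n))) x
    any-restrict x = begin
      any (λ a → lookup A a ∧ lookup (P a) x) (allFin n)
        ≡⟨ cong or (map-cong (λ a → sym (lookup-restrict A P a x)) (allFin n)) ⟩
      any (λ a → lookup (restrict A P a) x) (allFin n)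
        ≡⟨ cong or (map-∘ (allFin n)) ⟩
      any (λ p → lookup p x) (map (restrict A P) (allFin n))
        ≡⟨ lookup-⋃ (map (restrict A P) (allFin n)) x ⟨
      lookup (⋃ (map (restrict A P) (allFin n))) x ∎

DisjointOn : Subset m → (Fin m → Subset n) → Set
DisjointOn A P = ∀ {a b x} → a ∈ A → b ∈ A → x ∈ P a → x ∈ P b → a ≡ b

module _ {A : Subset n} where

  ∣bigUnion∣≡sum : ∀ {P : Fin n → Subset n} → DisjointOn A P →
                   ∣ bigUnion A P ∣ ≡ sum (map (∣_∣ ∘ restrict A P) (allFin n))
  ∣bigUnion∣≡sum {P} P-disj = begin
    ∣ bigUnion A P ∣                              ≡⟨ cong ∣_∣ (bigUnion≡⋃ A P) ⟩
    ∣ ⋃ (map (restrict A P) (allFin n)) ∣         ≡⟨ ∣⋃∣≡sum (map⁺ (AllPairs.map disjoint (allFin⁺ n))) ⟩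
    sum (map ∣_∣ (map (restrict A P) (allFin n))) ≡⟨ cong sum (map-∘ (allFin n)) ⟨
    sum (map (∣_∣ ∘ restrict A P) (allFin n))     ∎
    where
    open ≡-Reasoning
    disjoint : ∀ {a b} → ¬ a ≡ b → Disjoint (restrict A P a) (restrict A P b)
    disjoint a≢b x∈a x∈b with a∈A , x∈Pa ← ∈-restrict⁻ A P x∈a | b∈A , x∈Pb ← ∈-restrict⁻ A P x∈b
      = a≢b (P-disj a∈A b∈A x∈Pa x∈Pb)

  ∣bigUnion∣-cong : ∀ {P Q : Fin n → Subset n} → DisjointOn A P → DisjointOn A Q →
                    (∀ a → a ∈ A → ∣ P a ∣ ≡ ∣ Q a ∣) → ∣ bigUnion A P ∣ ≡ ∣ bigUnion A Q ∣
  ∣bigUnion∣-cong {P} {Q} P-disj Q-disj ∣P∣≡∣Q∣ = begin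
    ∣ bigUnion A P ∣                          ≡⟨ ∣bigUnion∣≡sum P-disj ⟩
    sum (map (∣_∣ ∘ restrict A P) (allFin n)) ≡⟨ cong sum (map-cong (∣restrict∣-cong A P Q ∣P∣≡∣Q∣) (allFin n)) ⟩
    sum (map (∣_∣ ∘ restrict A Q) (allFin n)) ≡⟨ ∣bigUnion∣≡sum Q-disj ⟨
    ∣ bigUnion A Q ∣                          ∎
    where open ≡-Reasoning

module _ (G : Graph n) where
  open Graph G

  private
    variable
      i j : ℕ
      u v w : Fin n

  walk-weaken : i ≤ j → Walk G i u v → Walk G j u v
  walk-weaken _         here       = here
  walk-weaken (s≤s i≤j) (step e p) = step e (walk-weaken i≤j p)

  walk-++ : Walk G i u v → Walk G j v w → Walk G (i + j) u w
  walk-++ {i = i} {j = j} here q = walk-weaken (m≤n+m j i) q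
  walk-++ (step e p) q   = step e (walk-++ p q)

  walk-∷ʳ : Walk G i u v → adj v w ≡ true → Walk G (suc i) u w
  walk-∷ʳ here       e = step e here
  walk-∷ʳ (step e p) e′ = step e (walk-∷ʳ p e′)

  walk-reverse : Walk G i u v → Walk G i v u
  walk-reverse here                         = here
  walk-reverse {u = u} (step {w = w} e p) = walk-∷ʳ (walk-reverse p) (trans (adj-sym w u) e)

  close? : ∀ u v → Dec (Close G u v)
  close? u v with u ≟ v | adj u v in e
  ... | yes refl | _     = yes here
  ... | no _     | true  = yes (step e here)
  ... | no u≢v   | false = no λ { here → u≢v refl ; (step e′ here) → contradiction (trans (sym e) e′) λ () }

  nbhd : Fin n → Subset n
  nbhd u = tabulate (λ v → ⌊ close? u v ⌋)

  ∈-nbhd⁺ : Close G u v → v ∈ nbhd u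
  ∈-nbhd⁺ u~v = ∈-tabulate⁺ (fromWitness u~v)

  ∈-nbhd⁻ : v ∈ nbhd u → Close G u v
  ∈-nbhd⁻ v∈N = toWitness (∈-tabulate⁻ v∈N)

  sevenIndependent-≡ : ∀ {A a b} → SevenIndependent G A → a ∈ A → b ∈ A →
                       Walk G i a w → Walk G j b w → i + j ≤ 6 → a ≡ b
  sevenIndependent-≡ {a = a} {b} indep a∈A b∈A p q i+j≤6 with a ≟ b
  ... | yes a≡b = a≡b
  ... | no a≢b  = contradiction (walk-weaken i+j≤6 (walk-++ p (walk-reverse q))) (indep a b a∈A b∈A a≢b)

∈-preimage⁺ : ∀ {φ : Fin n → Fin n} {u v} → φ u ≡ v → u ∈ preimage φ v
∈-preimage⁺ φu≡v = ∈-tabulate⁺ (fromWitness φu≡v)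

∈-preimage⁻ : ∀ {φ : Fin n → Fin n} {u v} → u ∈ preimage φ v → φ u ≡ v
∈-preimage⁻ u∈ = toWitness (∈-tabulate⁻ u∈)

∣preimage∣-mono : ∀ {φ ψ : Fin n → Fin n} {v} → (∀ u → φ u ≡ v → ψ u ≡ v) →
                  ∣ preimage φ v ∣ ≤ ∣ preimage ψ v ∣
∣preimage∣-mono {φ = φ} {ψ} {v} φ⇒ψ = p⊆q⇒∣p∣≤∣q∣ {p = preimage φ v} {preimage ψ v}
  (λ u∈ → ∈-preimage⁺ {φ = ψ} (φ⇒ψ _ (∈-preimage⁻ {φ = φ} u∈)))

zeroOn-∉ : ∀ {B : Subset n} {L : Fin n → ℕ} {v} → v ∉ B → zeroOn B L v ≡ L v
zeroOn-∉ {B = B} {v = v} v∉B with lookup B v in eq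
... | true  = contradiction (lookup⇒[]= v B eq) v∉B
... | false = refl

Repair : Graph n → Subset n → (Fin n → ℕ) → (Fin n → Fin n) → Subset n → Set
Repair {n} G S L φ₀ F = Σ (Fin n → Fin n) λ φF →
  (∀ u → φF u ∉ F) × ValidAssignment G S L φF × (∀ u → φ₀ u ∉ F → φF u ≡ φ₀ u)

Repairable : Graph n → Subset n → (Fin n → ℕ) → ℕ → (Fin n → Fin n) → Set
Repairable {n} G S L α φ₀ = (F : Subset n) → F ⊆ S → ∣ F ∣ ≤ α → Repair G S L φ₀ F

module FaultRepair {n} (G : Graph n) (L : Fin n → ℕ) (α : ℕ)
  {A : Subset n} (indep : SevenIndependent G A)
  {Bf : Fin n → Subset n} (∣Bf∣≡α : ∀ a → a ∈ A → ∣ Bf a ∣ ≡ α)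
  (Bf⊆nbhd : ∀ a v → a ∈ A → v ∈ Bf a → InN G a v)
  {S : Subset n} {φ₀ : Fin n → Fin n} (valid₀ : ValidAssignment G S L φ₀)
  (repair : Repairable G S L α φ₀)
  where

  private
    variable
      a b u v w : Fin n

    φ₀∈S : ∀ u → φ₀ u ∈ S
    φ₀∈S = proj₁ valid₀

    φ₀-close : ∀ u → Close G u (φ₀ u)
    φ₀-close = proj₁ (proj₂ valid₀)

    φ₀-capacity : ∀ v → v ∈ S → ∣ preimage φ₀ v ∣ ≤ L v
    φ₀-capacity = proj₂ (proj₂ valid₀)

  α<∣S∩nbhd∣ : ∀ a → α < ∣ S ∩ nbhd G a ∣
  α<∣S∩nbhd∣ a with α <? ∣ S ∩ nbhd G a ∣
  ... | yes α<∣S∩N∣ = α<∣S∩N∣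
  ... | no α≮∣S∩N∣
    with φ , avoids , (φ∈S , φ-close , _) , _ ← repair (S ∩ nbhd G a) (p∩q⊆p S (nbhd G a)) (≮⇒≥ α≮∣S∩N∣)
    = contradiction (x∈p∩q⁺ (φ∈S a , ∈-nbhd⁺ G (φ-close a))) (avoids a)

  seed : Fin n → Subset n
  seed a = restrict A Bf a ∩ S

  seed⊆S∩nbhd : ∀ a → seed a ⊆ S ∩ nbhd G a
  seed⊆S∩nbhd a x∈seed
    with x∈B , x∈S ← x∈p∩q⁻ (restrict A Bf a) S x∈seed
    with a∈A , x∈Bf ← ∈-restrict⁻ A Bf x∈B
    = x∈p∩q⁺ (x∈S , ∈-nbhd⁺ G (Bf⊆nbhd a _ a∈A x∈Bf))

  ∣seed∣≤α : ∀ a → ∣ seed a ∣ ≤ α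
  ∣seed∣≤α a = ≤-trans (∣p∩q∣≤∣p∣ (restrict A Bf a) S)
                       (∣restrict∣≤ A Bf (λ a a∈A → ≤-reflexive (∣Bf∣≡α a a∈A)) a)

  opaque
    faultSet : ∀ a → ∃[ F ] seed a ⊆ F × F ⊆ S ∩ nbhd G a × ∣ F ∣ ≡ α
    faultSet a = ⊆-interpolate (seed⊆S∩nbhd a) (∣seed∣≤α a) (<⇒≤ (α<∣S∩nbhd∣ a))

  F : Fin n → Subset n
  F a = proj₁ (faultSet a)

  seed⊆F : ∀ a → seed a ⊆ F a
  seed⊆F a = proj₁ (proj₂ (faultSet a))

  F⊆S∩nbhd : ∀ a → F a ⊆ S ∩ nbhd G a
  F⊆S∩nbhd a = proj₁ (proj₂ (proj₂ (faultSet a)))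

  ∣F∣≡α : ∀ a → ∣ F a ∣ ≡ α
  ∣F∣≡α a = proj₂ (proj₂ (proj₂ (faultSet a)))

  F⊆S : F a ⊆ S
  F⊆S {a} w∈F = proj₁ (x∈p∩q⁻ S (nbhd G a) (F⊆S∩nbhd a w∈F))

  F⊆nbhd : w ∈ F a → Close G a w
  F⊆nbhd {a = a} w∈F = ∈-nbhd⁻ G (proj₂ (x∈p∩q⁻ S (nbhd G a) (F⊆S∩nbhd a w∈F)))

  Bf∩S⊆F : a ∈ A → w ∈ Bf a → w ∈ S → w ∈ F a
  Bf∩S⊆F {a} a∈A w∈Bf w∈S = seed⊆F a (x∈p∩q⁺ (∈-restrict⁺ A Bf a∈A w∈Bf , w∈S))

  F-disjointOn : DisjointOn A F
  F-disjointOn a∈A b∈A w∈Fa w∈Fb =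
    sevenIndependent-≡ G indep a∈A b∈A (F⊆nbhd w∈Fa) (F⊆nbhd w∈Fb) (s≤s (s≤s z≤n))

  Bf-disjointOn : DisjointOn A Bf
  Bf-disjointOn {a} {b} a∈A b∈A w∈Ba w∈Bb =
    sevenIndependent-≡ G indep a∈A b∈A (Bf⊆nbhd a _ a∈A w∈Ba) (Bf⊆nbhd b _ b∈A w∈Bb) (s≤s (s≤s z≤n))

  U : Subset n
  U = bigUnion A F

  U⊆S : U ⊆ S
  U⊆S w∈U with _ , _ , w∈F ← ∈-bigUnion⁻ A F w∈U = F⊆S w∈F

  ∣U∣≡∣B∣ : ∣ U ∣ ≡ ∣ bigUnion A Bf ∣
  ∣U∣≡∣B∣ = ∣bigUnion∣-cong F-disjointOn Bf-disjointOn
              (λ a a∈A → trans (∣F∣≡α a) (sym (∣Bf∣≡α a a∈A)))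

  ∈S─U⇒∉B : w ∈ S ─ U → w ∉ bigUnion A Bf
  ∈S─U⇒∉B w∈S─U w∈B with a , a∈A , w∈Bf ← ∈-bigUnion⁻ A Bf w∈B =
    x∈p─q⇒x∉q S U w∈S─U (∈-bigUnion⁺ A F a∈A (Bf∩S⊆F a∈A w∈Bf (p─q⊆p S U w∈S─U)))

  private
    repairAt : ∀ a → Repair G S L φ₀ (F a)
    repairAt a = repair (F a) F⊆S (≤-reflexive (∣F∣≡α a))

  ψ : Fin n → Fin n → Fin n
  ψ a = proj₁ (repairAt a)

  ψ∉F : ∀ a u → ψ a u ∉ F a
  ψ∉F a = proj₁ (proj₂ (repairAt a))

  ψ∈S : ∀ a u → ψ a u ∈ S
  ψ∈S a = proj₁ (proj₁ (proj₂ (proj₂ (repairAt a))))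

  ψ-close : ∀ a u → Close G u (ψ a u)
  ψ-close a = proj₁ (proj₂ (proj₁ (proj₂ (proj₂ (repairAt a)))))

  ψ-capacity : ∀ a v → v ∈ S → ∣ preimage (ψ a) v ∣ ≤ L v
  ψ-capacity a = proj₂ (proj₂ (proj₁ (proj₂ (proj₂ (repairAt a)))))

  ψ-conservative : ∀ a u → φ₀ u ∉ F a → ψ a u ≡ φ₀ u
  ψ-conservative a = proj₂ (proj₂ (proj₂ (repairAt a)))

  ψ-near : φ₀ u ∈ F a → Walk G 3 a (ψ a u)
  ψ-near {u} {a} φ₀u∈F = walk-++ G (walk-++ G (F⊆nbhd φ₀u∈F) (walk-reverse G (φ₀-close u))) (ψ-close a u)

  ψ∉U : a ∈ A → φ₀ u ∈ F a → ψ a u ∉ U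
  ψ∉U {a} {u} a∈A φ₀u∈F ψ∈U
    with b , b∈A , ψ∈Fb ← ∈-bigUnion⁻ A F ψ∈U
    with refl ← sevenIndependent-≡ G indep a∈A b∈A (ψ-near φ₀u∈F) (F⊆nbhd ψ∈Fb) (s≤s (s≤s (s≤s (s≤s z≤n))))
    = ψ∉F a u ψ∈Fb

  Owner : Fin n → Fin n → Set
  Owner u a = a ∈ A × φ₀ u ∈ F a

  owner? : ∀ u → Dec (∃ (Owner u))
  owner? u = map′ (∈-bigUnion⁻ A F) (λ (_ , a∈A , φ₀u∈F) → ∈-bigUnion⁺ A F a∈A φ₀u∈F) (φ₀ u ∈? U)

  φ : Fin n → Fin n
  φ u with owner? u
  ... | yes (a , _) = ψ a u
  ... | no _        = φ₀ u

  φ-owned : Owner u a → φ u ≡ ψ a u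
  φ-owned {u} (a∈A , φ₀u∈F) with owner? u
  ... | yes (b , b∈A , φ₀u∈Fb) = cong (λ c → ψ c u) (F-disjointOn b∈A a∈A φ₀u∈Fb φ₀u∈F)
  ... | no ∄owner              = contradiction (_ , a∈A , φ₀u∈F) ∄owner

  φ-unowned : ¬ ∃ (Owner u) → φ u ≡ φ₀ u
  φ-unowned {u} ∄owner with owner? u
  ... | yes owner = contradiction owner ∄owner
  ... | no _      = refl

  φ∈S─U : ∀ u → φ u ∈ S ─ U
  φ∈S─U u with owner? u
  ... | yes (a , a∈A , φ₀u∈F) = x∈p∧x∉q⇒x∈p─q (ψ∈S a u) (ψ∉U a∈A φ₀u∈F)
  ... | no ∄owner             = x∈p∧x∉q⇒x∈p─q (φ₀∈S u) (∄owner ∘ ∈-bigUnion⁻ A F)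

  φ-close : ∀ u → Close G u (φ u)
  φ-close u with owner? u
  ... | yes (a , _) = ψ-close a u
  ... | no _        = φ₀-close u

  -- Every centre used by ψ a is within distance 3 of a, so by 7-independence no other
  -- repair sends vertices to it.
  served-by-ψ : a ∈ A → φ₀ w ∈ F a → ψ a w ≡ v → ∀ u → φ u ≡ v → ψ a u ≡ v
  served-by-ψ {a} {w} {v} a∈A φ₀w∈F ψw≡v u φu≡v with owner? u
  ... | no ∄owner = trans (ψ-conservative a u (λ φ₀u∈F → ∄owner (a , a∈A , φ₀u∈F))) φu≡v
  ... | yes (b , b∈A , φ₀u∈Fb)
    with refl ← sevenIndependent-≡ G indep a∈A b∈A
                  (subst (Walk G 3 a) ψw≡v (ψ-near φ₀w∈F)) (subst (Walk G 3 b) φu≡v (ψ-near φ₀u∈Fb)) ≤-refl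
    = φu≡v

  φ-capacity : ∀ v → v ∈ S → ∣ preimage φ v ∣ ≤ L v
  φ-capacity v v∈S with any? (λ u → owner? u ×-dec φ u ≟ v)
  ... | yes (w , (a , a∈A , φ₀w∈F) , φw≡v) =
    ≤-trans (∣preimage∣-mono (served-by-ψ a∈A φ₀w∈F (trans (sym (φ-owned (a∈A , φ₀w∈F))) φw≡v)))
            (ψ-capacity a v v∈S)
  ... | no ∄rerouted = ≤-trans (∣preimage∣-mono served-by-φ₀) (φ₀-capacity v v∈S)
    where
    served-by-φ₀ : ∀ u → φ u ≡ v → φ₀ u ≡ v
    served-by-φ₀ u φu≡v = trans (sym (φ-unowned λ owner → ∄rerouted (u , owner , φu≡v))) φu≡v

  φ-valid : ValidAssignment G (S ─ U) (zeroOn (bigUnion A Bf) L) φ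
  φ-valid = φ∈S─U , φ-close , λ v v∈S─U →
    subst (∣ preimage φ v ∣ ≤_) (sym (zeroOn-∉ {L = L} (∈S─U⇒∉B v∈S─U))) (φ-capacity v (p─q⊆p S U v∈S─U))

lemma2 : {n : ℕ} (G : Graph n) (k α : ℕ) (L : Fin n → ℕ) → α < k →
         (A : Subset n) → SevenIndependent G A →
         (Bf : Fin n → Subset n) →
         (∀ a → a ∈ A → ∣ Bf a ∣ ≡ α) →
         (∀ a v → a ∈ A → v ∈ Bf a → InN G a v) →
         ConsFTFeasible G k L α →
         CapFeasible G (k ∸ ∣ bigUnion A Bf ∣) (zeroOn (bigUnion A Bf) L)
lemma2 G k α L _ A indep Bf ∣Bf∣≡α Bf⊆nbhd (S , ∣S∣≡k , φ₀ , valid₀ , repair) =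
  S ─ U , ∣S─U∣≡k∸∣B∣ , φ , φ-valid
  where
  open FaultRepair G L α indep ∣Bf∣≡α Bf⊆nbhd valid₀ repair
  open ≡-Reasoning

  ∣S─U∣≡k∸∣B∣ : ∣ S ─ U ∣ ≡ k ∸ ∣ bigUnion A Bf ∣
  ∣S─U∣≡k∸∣B∣ = begin
    ∣ S ─ U ∣             ≡⟨ ∣p─q∣≡∣p∣∸∣q∣ S U U⊆S ⟩
    ∣ S ∣ ∸ ∣ U ∣         ≡⟨ cong₂ _∸_ ∣S∣≡k ∣U∣≡∣B∣ ⟩
    k ∸ ∣ bigUnion A Bf ∣ ∎
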